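{- Let $q$ be a power of $2$ with $q>4$, and let $S\subseteq GF(q)^3$ be a vector space over $GF(q)$ such that $\mathrm{Matroid}(S)$ is isomorphic to the cycle matroid of $A_3$. Then $\mathrm{mult}(S)$ has $C_5^2$ as a minor.
   Context: $A_3$ is the graph with two vertices and three parallel edges between them. $\mathrm{Matroid}(S)$ is the matroid on $[n]$ represented over $GF(q)$ by any matrix $A$ with $S=\{x:Ax=\mathbf{0}\}$; its circuits are the inclusion-minimal sets among $\{\mathrm{support}(x):x\in S,x\neq\mathbf{0}\}$. A clutter over $V$ is a family of subsets of $V$, no member containing another; for disjoint $I,J\subseteq V$ the minor $\mathcal{C}\setminus I/J$ is the clutter over $V-(I\cup J)$ of inclusion-minimal sets of $\{C-J:C\in\mathcal{C},C\cap I=\emptyset\}$. $\mathrm{mult}(S)$ is the clutter over $V_1\cup\cdots\cup V_n$ ($V_i$ disjoint copies of $GF(q)$) with members $\{x_1,\dots,x_n\}$ ($x_i$ in copy $V_i$) for $(x_1,\dots,x_n)\in S$. $C_5^2$ is the clutter over $\{1,\dots,5\}$ with members $\{1,2\},\{2,3\},\{3,4\},\{4,5\},\{5,1\}$; having it as a minor means some minor is isomorphic to it. -}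

module Defs where

open import Level using (0ℓ)
open import Data.Nat using (ℕ; _^_; _<_)
open import Data.Fin using (Fin; zero; suc)
open import Data.Fin.Properties using () renaming (_≟_ to _≟F_)
open import Data.Bool using (Bool; true; false)
open import Data.Product using (Σ; ∃; ∃-syntax; _×_; _,_)
open import Relation.Binary.PropositionalEquality using (_≡_; _≢_)
open import Relation.Nullary using (¬_)
open import Relation.Nullary.Decidable using (⌊_⌋)
open import Algebra.Core using (Op₁; Op₂)
open import Algebra.Structures using (IsCommutativeRing)
open import Function.Bundles using (_↔_; Inverse; _⇔_)
open import Function.Definitions using (Injective)
open import Data.Sum using (_⊎_)

-- Finite fields.  A field structure on the carrier Fin q (with
-- propositional equality).  GF(q) is any such structure (all fields
-- with q elements are isomorphic).

record FieldOn (q : ℕ) : Set where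
  field
    _+_ _*_ : Op₂ (Fin q)
    -_      : Op₁ (Fin q)
    0# 1#   : Fin q
    isCommutativeRing : IsCommutativeRing _≡_ _+_ _*_ -_ 0# 1#
    0≢1     : 0# ≢ 1#
    inverse : ∀ x → x ≢ 0# → ∃[ y ] (x * y ≡ 1#)

IsPowerOf2 : ℕ → Set
IsPowerOf2 q = ∃[ k ] (q ≡ 2 ^ k)

_≐_ : {A : Set} → (A → Bool) → (A → Bool) → Set
D ≐ E = ∀ v → D v ≡ E v

_⊆_ : {A : Set} → (A → Bool) → (A → Bool) → Set
D ⊆ E = ∀ v → D v ≡ true → E v ≡ true

module _ {q : ℕ} (F : FieldOn q) where
  open FieldOn F

  Vector : ℕ → Set
  Vector n = Fin n → Fin q

  zeroVec : ∀ {n} → Vector n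
  zeroVec _ = 0#

  record IsSubspace {n : ℕ} (S : Vector n → Set) : Set where
    field
      zero-∈ : S zeroVec
      +-∈    : ∀ x y → S x → S y → S (λ i → x i + y i)
      ·-∈    : ∀ c x → S x → S (λ i → c * x i)

  support : ∀ {n} → Vector n → (Fin n → Bool)
  support x i = Data.Bool.not ⌊ x i ≟F 0# ⌋

  NonZeroVec : ∀ {n} → Vector n → Set
  NonZeroVec x = ∃[ i ] (x i ≢ 0#)

  IsSupportOf : ∀ {n} → (Vector n → Set) → (Fin n → Bool) → Set
  IsSupportOf S K = ∃[ x ] (S x × NonZeroVec x × support x ≐ K)

  IsCircuit : ∀ {n} → (Vector n → Set) → (Fin n → Bool) → Set
  IsCircuit S K = IsSupportOf S K × (∀ K′ → IsSupportOf S K′ → K′ ⊆ K → K′ ≐ K)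

  -- mult(S): clutter over V = V₁ ∪ … ∪ Vₙ, encoded as Fin n × Fin q
  -- (the pair (i , a) is the copy of a ∈ GF(q) in V_i).

  Ground : ℕ → Set
  Ground n = Fin n × Fin q

  memberOf : ∀ {n} → Vector n → (Ground n → Bool)
  memberOf x (i , a) = ⌊ a ≟F x i ⌋

  mult : ∀ {n} → (Vector n → Set) → (Ground n → Bool) → Set
  mult S D = ∃[ x ] (S x × D ≐ memberOf x)

Clutter : Set → Set₁
Clutter V = (V → Bool) → Set

Disjoint : {V : Set} → (V → Bool) → (V → Bool) → Set
Disjoint I J = ∀ v → I v ≡ true → J v ≡ false

_∸ˢ_ : {V : Set} → (V → Bool) → (V → Bool) → (V → Bool)
(C ∸ˢ J) v = C v Data.Bool.∧ Data.Bool.not (J v)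

minorCandidate : {V : Set} → Clutter V → (I J : V → Bool) → (V → Bool) → Set
minorCandidate 𝒞 I J D = ∃[ C ] (𝒞 C × Disjoint C I × D ≐ (C ∸ˢ J))

-- members of 𝒞 \ I / J : inclusion-minimal candidates
-- (they are automatically subsets of V - (I ∪ J))
minor : {V : Set} → Clutter V → (I J : V → Bool) → Clutter V
minor 𝒞 I J D =
  minorCandidate 𝒞 I J D × (∀ D′ → minorCandidate 𝒞 I J D′ → D′ ⊆ D → D′ ≐ D)

InMinorGround : {V : Set} → (I J : V → Bool) → V → Set
InMinorGround I J v = I v ≡ false × J v ≡ false

next5 : Fin 5 → Fin 5
next5 zero = suc zero
next5 (suc zero) = suc (suc zero)
next5 (suc (suc zero)) = suc (suc (suc zero))
next5 (suc (suc (suc zero))) = suc (suc (suc (suc zero)))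
next5 (suc (suc (suc (suc zero)))) = zero

C₅² : Clutter (Fin 5)
C₅² E = ∃[ i ] (∀ j → (E j ≡ true) ⇔ (j ≡ i ⊎ j ≡ next5 i))

HasC₅²Minor : {V : Set} → Clutter V → Set
HasC₅²Minor {V} 𝒞 =
  ∃[ I ] ∃[ J ] (Disjoint I J ×
    ∃[ φ ] (Injective _≡_ _≡_ φ
          × (∀ i → InMinorGround I J (φ i))
          × (∀ v → InMinorGround I J v → ∃[ i ] (φ i ≡ v))
          × (∀ (D : V → Bool) →
               minor 𝒞 I J D ⇔ ((∀ v → D v ≡ true → InMinorGround I J v)
                                × C₅² (λ i → D (φ i))))))

-- The cycle matroid of A₃ (two vertices, three parallel edges, edges
-- indexed by Fin 3): its circuits (edge sets of cycles) are exactly the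
-- pairs of distinct edges.

A₃-circuit : (Fin 3 → Bool) → Set
A₃-circuit K = ∃[ e ] ∃[ f ] (e ≢ f × (∀ g → (K g ≡ true) ⇔ (g ≡ e ⊎ g ≡ f)))

MatroidIsoA₃ : {q : ℕ} (F : FieldOn q) → ((Fin 3 → Fin q) → Set) → Set
MatroidIsoA₃ F S =
  Σ (Fin 3 ↔ Fin 3) λ σ → (∀ (K : Fin 3 → Bool) →
           IsCircuit F S K ⇔ A₃-circuit (λ e → K (Inverse.from σ e)))

{-# OPTIONS --safe #-}
-- Since every pair of coordinates carries a circuit and no coordinate is a loop, after rescaling
-- the coordinates S = {(a, a + b, b)}.  Pick nonzero e, f, g and keep only the values 0, e, g in
-- the first copy of GF(q), g, e, f, e + f in the second and 0, f, g in the third; then contract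
-- g in the outer copies and e, f, e + f in the middle one.  The vectors (0, f, f), (e, e + f, f),
-- (e, e, 0), (g, g, 0), (0, g, g) leave the five edges of the pentagon 0₁ f₃ e₁ 0₃ g₂, and the
-- conditions on e, f, g exclude every other vector of S whose entries are all kept.
module Submission where

open import Defs
open import Data.Nat using (ℕ; _<_; s≤s; z≤n)
open import Data.Nat.Properties using (<-trans; <⇒≱)
open import Data.Fin using (Fin)
open import Data.Fin.Patterns using (0F; 1F; 2F; 3F; 4F)
open import Data.Fin.Properties using (¬∀⟶∃¬; injective⇒≤) renaming (_≟_ to _≟F_)
open import Data.Bool using (Bool; true; false; not; _∧_; if_then_else_)
open import Data.Bool.Properties using (¬-not; not-injective)
open import Data.Product using (∃; ∃-syntax; _×_; _,_; proj₁; proj₂)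
open import Data.Product.Properties using (≡-dec)
open import Data.Sum using (_⊎_; inj₁; inj₂; [_,_]′)
import Data.Sum as Sum
open import Data.List using (List; []; _∷_; _++_; map; length; lookup)
open import Data.List.Relation.Unary.Any using (here; there; index)
open import Data.List.Relation.Unary.Any.Properties using (lookup-index)
open import Data.List.Relation.Unary.All using ([]; _∷_)
open import Data.List.Relation.Unary.All.Properties using (All¬⇒¬Any)
open import Data.List.Membership.Propositional using (_∈_; _∉_)
open import Data.List.Membership.Propositional.Properties
  using (∈-map⁺; ∈-map⁻; ∈-++⁺ˡ; ∈-++⁺ʳ; ∈-++⁻)
import Data.List.Membership.DecPropositional as DecMembership
open import Relation.Nullary using (¬_; Dec; yes; no; contradiction)
open import Relation.Nullary.Decidable using (⌊_⌋)
open import Relation.Binary.Definitions using (DecidableEquality)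
open import Relation.Binary.PropositionalEquality
open import Function using (_∘_)
open import Function.Bundles using (_⇔_; mk⇔; Equivalence; Inverse)
open import Function.Construct.Composition using (_⇔-∘_)
open import Function.Definitions using (Injective)
open import Algebra.Bundles using (CommutativeRing)
import Algebra.Properties.Ring as RingProperties

open Equivalence using (to; from)

⌊⌋-true⇔ : ∀ {p} {P : Set p} (P? : Dec P) → (⌊ P? ⌋ ≡ true) ⇔ P
⌊⌋-true⇔ (yes p) = mk⇔ (λ _ → p) (λ _ → refl)
⌊⌋-true⇔ (no ¬p) = mk⇔ (λ ()) (λ p → contradiction p ¬p)

⌊⌋-false : ∀ {p} {P : Set p} (P? : Dec P) → ¬ P → ⌊ P? ⌋ ≡ false
⌊⌋-false P? ¬p = ¬-not (¬p ∘ to (⌊⌋-true⇔ P?))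

⊆-antisym : {A : Set} {D E : A → Bool} → D ⊆ E → E ⊆ D → D ≐ E
⊆-antisym D⊆E E⊆D v = ≡-by-true (D⊆E v) (E⊆D v)
  where
  ≡-by-true : ∀ {a b} → (a ≡ true → b ≡ true) → (b ≡ true → a ≡ true) → a ≡ b
  ≡-by-true {true}          a⇒b _   = sym (a⇒b refl)
  ≡-by-true {false} {true}  _   b⇒a = b⇒a refl
  ≡-by-true {false} {false} _   _   = refl

∈-pair⇔ : {A : Set} {v a b : A} → (v ∈ a ∷ b ∷ []) ⇔ (v ≡ a ⊎ v ≡ b)
∈-pair⇔ = mk⇔ (λ { (here p) → inj₁ p ; (there (here p)) → inj₂ p ; (there (there ())) })
              [ here , there ∘ here ]′

∃-∉ : ∀ {q} (xs : List (Fin q)) → length xs < q → ∃ (_∉ xs)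
∃-∉ {q} xs |xs|<q = ¬∀⟶∃¬ q (_∈ xs) (_∈? xs) not-all-in
  where
  open DecMembership _≟F_ using (_∈?_)
  not-all-in : ¬ (∀ x → x ∈ xs)
  not-all-in all-in = <⇒≱ |xs|<q (injective⇒≤ position-injective)
    where
    position-injective : Injective _≡_ _≡_ (λ x → index (all-in x))
    position-injective {x} {y} eq =
      trans (lookup-index (all-in x)) (trans (cong (lookup xs) eq) (sym (lookup-index (all-in y))))

module FieldProperties {q : ℕ} (F : FieldOn q) where
  open FieldOn F public using (inverse; 0≢1)

  commutativeRing : CommutativeRing _ _
  commutativeRing = record { isCommutativeRing = FieldOn.isCommutativeRing F }

  open CommutativeRing commutativeRing public
    using (_+_; _*_; -_; 0#; 1#; +-comm; +-assoc; +-identityˡ; +-identityʳ; -‿inverseʳ;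
           *-assoc; *-comm; *-identityʳ; distribˡ; distribʳ; zeroˡ; zeroʳ; ring)
  open RingProperties ring public
    using (+-cancelˡ; +-cancelʳ; +-identityˡ-unique; +-identityʳ-unique; -1*x≈-x; x∙y⁻¹≈ε⇒x≈y)
  open ≡-Reasoning

  1≢0 : 1# ≢ 0#
  1≢0 = 0≢1 ∘ sym

  *-cancelʳ-≢0 : ∀ {k} → k ≢ 0# → ∀ a b → a * k ≡ b * k → a ≡ b
  *-cancelʳ-≢0 {k} k≢0 a b ak≡bk with inverse k k≢0
  ... | k⁻¹ , kk⁻¹≡1 = begin
    a              ≡⟨ sym (*-identityʳ a) ⟩
    a * 1#         ≡⟨ cong (a *_) (sym kk⁻¹≡1) ⟩
    a * (k * k⁻¹)  ≡⟨ sym (*-assoc a k k⁻¹) ⟩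
    a * k * k⁻¹    ≡⟨ cong (_* k⁻¹) ak≡bk ⟩
    b * k * k⁻¹    ≡⟨ *-assoc b k k⁻¹ ⟩
    b * (k * k⁻¹)  ≡⟨ cong (b *_) kk⁻¹≡1 ⟩
    b * 1#         ≡⟨ *-identityʳ b ⟩
    b              ∎

  *-≢0 : ∀ {a b} → a ≢ 0# → b ≢ 0# → a * b ≢ 0#
  *-≢0 {a} {b} a≢0 b≢0 ab≡0 = a≢0 (*-cancelʳ-≢0 b≢0 a 0# (trans ab≡0 (sym (zeroˡ b))))

  x+x≡x*2 : ∀ x → x + x ≡ x * (1# + 1#)
  x+x≡x*2 x = sym (trans (distribˡ x 1# 1#) (cong₂ _+_ (*-identityʳ x) (*-identityʳ x)))

  x-y≡0⇔x≡y : ∀ x y → (x + - 1# * y ≡ 0#) ⇔ (x ≡ y)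
  x-y≡0⇔x≡y x y = mk⇔ (x∙y⁻¹≈ε⇒x≈y x y ∘ trans (cong (x +_) (sym (-1*x≈-x y))))
                      (λ { refl → trans (cong (x +_) (-1*x≈-x x)) (-‿inverseʳ x) })

-- Minors of clutters

module _ {V K : Set} {𝒞 : Clutter V} {I J : V → Bool} (E : K → V → Bool)
         (E-candidate : ∀ k → minorCandidate 𝒞 I J (E k))
         (candidate-⊇ : ∀ D → minorCandidate 𝒞 I J D → ∃[ k ] (E k ⊆ D))
         (E-antichain : ∀ j k → E j ⊆ E k → j ≡ k) where

  minor⇔≐ : ∀ D → minor 𝒞 I J D ⇔ (∃[ k ] (D ≐ E k))
  minor⇔≐ D = mk⇔ member⇒E E⇒member
    where
    member⇒E : minor 𝒞 I J D → ∃[ k ] (D ≐ E k)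
    member⇒E (D-candidate , D-minimal) with candidate-⊇ D D-candidate
    ... | k , Ek⊆D = k , λ v → sym (D-minimal (E k) (E-candidate k) Ek⊆D v)

    E⇒member : ∃[ k ] (D ≐ E k) → minor 𝒞 I J D
    E⇒member (k , D≐Ek) = D-candidate , D-minimal
      where
      D-candidate : minorCandidate 𝒞 I J D
      D-candidate with E-candidate k
      ... | C , C∈𝒞 , C∩I , Ek≐C-J = C , C∈𝒞 , C∩I , λ v → trans (D≐Ek v) (Ek≐C-J v)

      D-minimal : ∀ D′ → minorCandidate 𝒞 I J D′ → D′ ⊆ D → D′ ≐ D
      D-minimal D′ D′-candidate D′⊆D with candidate-⊇ D′ D′-candidate
      ... | j , Ej⊆D′ with E-antichain j k (λ v → trans (sym (D≐Ek v)) ∘ D′⊆D v ∘ Ej⊆D′ v)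
      ... | refl = ⊆-antisym D′⊆D (λ v → Ej⊆D′ v ∘ trans (sym (D≐Ek v)))

-- The pentagon C₅²

next5-fixedPointFree : ∀ k → next5 k ≢ k
next5-fixedPointFree 0F ()
next5-fixedPointFree 1F ()
next5-fixedPointFree 2F ()
next5-fixedPointFree 3F ()
next5-fixedPointFree 4F ()

next5²-fixedPointFree : ∀ k → next5 (next5 k) ≢ k
next5²-fixedPointFree 0F ()
next5²-fixedPointFree 1F ()
next5²-fixedPointFree 2F ()
next5²-fixedPointFree 3F ()
next5²-fixedPointFree 4F ()

module Pentagon {V : Set} (_≟_ : DecidableEquality V) (G : V → Set) (φ : Fin 5 → V)
                (φ-injective : Injective _≡_ _≡_ φ) (φ-∈G : ∀ i → G (φ i))
                (G-onto : ∀ v → G v → ∃[ i ] (φ i ≡ v)) where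
  open DecMembership _≟_ using (_∈?_)

  edge : Fin 5 → V → Bool
  edge k v = ⌊ v ∈? φ k ∷ φ (next5 k) ∷ [] ⌋

  edge-true⇔ : ∀ k v → (edge k v ≡ true) ⇔ (v ≡ φ k ⊎ v ≡ φ (next5 k))
  edge-true⇔ k v = ∈-pair⇔ ⇔-∘ ⌊⌋-true⇔ (v ∈? _)

  φ-on-edge⇔ : ∀ i k → (edge k (φ i) ≡ true) ⇔ (i ≡ k ⊎ i ≡ next5 k)
  φ-on-edge⇔ i k = mk⇔ (Sum.map φ-injective φ-injective) (Sum.map (cong φ) (cong φ))
                   ⇔-∘ edge-true⇔ k (φ i)

  edge-antichain : ∀ j k → edge j ⊆ edge k → j ≡ k
  edge-antichain j k Ej⊆Ek = by-ends (on-k j (inj₁ refl)) (on-k (next5 j) (inj₂ refl))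
    where
    on-k : ∀ i → i ≡ j ⊎ i ≡ next5 j → i ≡ k ⊎ i ≡ next5 k
    on-k i = to (φ-on-edge⇔ i k) ∘ Ej⊆Ek (φ i) ∘ from (φ-on-edge⇔ i j)

    by-ends : j ≡ k ⊎ j ≡ next5 k → next5 j ≡ k ⊎ next5 j ≡ next5 k → j ≡ k
    by-ends (inj₁ j≡k) _ = j≡k
    by-ends (inj₂ j≡k′) (inj₁ j′≡k) =
      contradiction (trans (cong next5 (sym j≡k′)) j′≡k) (next5²-fixedPointFree k)
    by-ends (inj₂ j≡k′) (inj₂ j′≡k′) =
      contradiction (trans j′≡k′ (sym j≡k′)) (next5-fixedPointFree j)

  ≐edge⇔C₅² : ∀ D → (∃[ k ] (D ≐ edge k)) ⇔ ((∀ v → D v ≡ true → G v) × C₅² (D ∘ φ))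
  ≐edge⇔C₅² D = mk⇔ edge⇒C₅² C₅²⇒edge
    where
    edge⇒C₅² : ∃[ k ] (D ≐ edge k) → (∀ v → D v ≡ true → G v) × C₅² (D ∘ φ)
    edge⇒C₅² (k , D≐Ek) = D⊆G , k , λ i →
      φ-on-edge⇔ i k ⇔-∘ mk⇔ (trans (sym (D≐Ek (φ i)))) (trans (D≐Ek (φ i)))
      where
      D⊆G : ∀ v → D v ≡ true → G v
      D⊆G v Dv with to (edge-true⇔ k v) (trans (sym (D≐Ek v)) Dv)
      ... | inj₁ refl = φ-∈G k
      ... | inj₂ refl = φ-∈G (next5 k)

    C₅²⇒edge : (∀ v → D v ≡ true → G v) × C₅² (D ∘ φ) → ∃[ k ] (D ≐ edge k)
    C₅²⇒edge (D⊆G , k , D∘φ⇔) = k , ⊆-antisym D⊆Ek Ek⊆D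
      where
      D⊆Ek : D ⊆ edge k
      D⊆Ek v Dv with G-onto v (D⊆G v Dv)
      ... | i , refl = from (φ-on-edge⇔ i k) (to (D∘φ⇔ i) Dv)

      Ek⊆D : edge k ⊆ D
      Ek⊆D v Ekv with to (edge-true⇔ k v) Ekv
      ... | inj₁ refl = from (D∘φ⇔ k) (inj₁ refl)
      ... | inj₂ refl = from (D∘φ⇔ (next5 k)) (inj₂ refl)

-- The clutter mult(S)

module Mult {q : ℕ} (F : FieldOn q) {n : ℕ} where
  _∋_ : Vector F n → Ground F n → Set
  x ∋ (p , c) = x p ≡ c

  ∋⇒graph : ∀ {x : Vector F n} {v} → x ∋ v → (proj₁ v , x (proj₁ v)) ≡ v
  ∋⇒graph refl = refl

  memberOf-true⇔ : ∀ (x : Vector F n) v → (memberOf F x v ≡ true) ⇔ (x ∋ v)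
  memberOf-true⇔ x (p , c) = mk⇔ sym sym ⇔-∘ ⌊⌋-true⇔ (c ≟F x p)

  module _ (x : Vector F n) (E J : Ground F n → Bool)
           (E-on-x : ∀ v → E v ≡ true → x ∋ v × J v ≡ false) where

    ⊆-memberOf-∸ : E ⊆ (memberOf F x ∸ˢ J)
    ⊆-memberOf-∸ v Ev with E-on-x v Ev
    ... | x∋v , Jv≡false = cong₂ (λ a b → a ∧ not b) (from (memberOf-true⇔ x v) x∋v) Jv≡false

    memberOf-∸-≐ : (∀ p → E (p , x p) ≡ true ⊎ J (p , x p) ≡ true) → (memberOf F x ∸ˢ J) ≐ E
    memberOf-∸-≐ cover = ⊆-antisym ∸⊆E ⊆-memberOf-∸
      where
      ∸⊆E : (memberOf F x ∸ˢ J) ⊆ E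
      ∸⊆E (p , c) with c ≟F x p
      ... | no _ = λ ()
      ... | yes refl with cover p
      ...   | inj₁ E-true = λ _ → E-true
      ...   | inj₂ J-true rewrite J-true = λ ()

  VectorCandidate : (Vector F n → Set) → (I J : Ground F n → Bool) → (Ground F n → Bool) → Set
  VectorCandidate S I J D = ∃[ x ] (S x × (∀ p → I (p , x p) ≡ false) × D ≐ (memberOf F x ∸ˢ J))

  mult-candidate⇔ : ∀ {S : Vector F n → Set} {I J} D →
    minorCandidate (mult F S) I J D ⇔ VectorCandidate S I J D
  mult-candidate⇔ {S} {I} {J} D = mk⇔ candidate⇒vector vector⇒candidate
    where
    candidate⇒vector : minorCandidate (mult F S) I J D → VectorCandidate S I J D
    candidate⇒vector (C , (x , x∈S , C≐x) , C∩I , D≐C-J) =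
      x , x∈S , (λ p → C∩I (p , x p) (trans (C≐x _) (from (memberOf-true⇔ x _) refl)))
        , λ v → trans (D≐C-J v) (cong (λ b → b ∧ not (J v)) (C≐x v))

    vector⇒candidate : VectorCandidate S I J D → minorCandidate (mult F S) I J D
    vector⇒candidate (x , x∈S , x∩I , D≐) = memberOf F x , (x , x∈S , λ _ → refl) , x-disjoint , D≐
      where
      x-disjoint : Disjoint (memberOf F x) I
      x-disjoint (p , c) x∋v with to (memberOf-true⇔ x (p , c)) x∋v
      ... | refl = x∩I p

module _ {q : ℕ} (F : FieldOn q) {n : ℕ} (x : Vector F n) where
  open FieldOn F using (0#)

  support-true⇔ : ∀ i → (support F x i ≡ true) ⇔ (x i ≢ 0#)
  support-true⇔ i with x i ≟F 0#
  ... | yes xi≡0 = mk⇔ (λ ()) (λ xi≢0 → contradiction xi≡0 xi≢0)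
  ... | no xi≢0  = mk⇔ (λ _ → xi≢0) (λ _ → refl)

  support-false⇒≡0 : ∀ i → support F x i ≡ false → x i ≡ 0#
  support-false⇒≡0 i with x i ≟F 0#
  ... | yes xi≡0 = λ _ → xi≡0
  ... | no _     = λ ()

  support-≐ : ∀ {K} → (∀ i → (K i ≡ true) ⇔ (x i ≢ 0#)) → support F x ≐ K
  support-≐ K⇔ = ⊆-antisym (λ i → from (K⇔ i) ∘ to (support-true⇔ i))
                           (λ i → from (support-true⇔ i) ∘ to (K⇔ i))

record Parametrisation {q : ℕ} (F : FieldOn q) (S : Vector F 3 → Set) : Set where
  open FieldProperties F
  field
    κ   : Fin 3 → Fin q
    κ≢0 : ∀ p → κ p ≢ 0#

  coord : Fin 3 → Fin q → Fin q
  coord p t = t * κ p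

  field
    point   : Fin q → Fin q → Vector F 3
    point-∈ : ∀ a b → S (point a b)
    point₀  : ∀ a b → point a b 0F ≡ coord 0F a
    point₁  : ∀ a b → point a b 1F ≡ coord 1F (a + b)
    point₂  : ∀ a b → point a b 2F ≡ coord 2F b
    middle  : ∀ {x} a b → S x → x 0F ≡ coord 0F a → x 2F ≡ coord 2F b → x 1F ≡ coord 1F (a + b)

module SubspaceOfA₃ {q : ℕ} (F : FieldOn q) {S : Vector F 3 → Set}
                    (S-subspace : IsSubspace F S) (iso : MatroidIsoA₃ F S) where
  open FieldProperties F
  open IsSubspace S-subspace
  open Inverse (proj₁ iso) using (inverseˡ; inverseʳ) renaming (to to σ; from to σ⁻¹)
  open DecMembership (_≟F_ {3}) using (_∈?_)
  open ≡-Reasoning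

  σ⁻¹≡⇔ : ∀ {e i} → (σ⁻¹ e ≡ i) ⇔ (e ≡ σ i)
  σ⁻¹≡⇔ = mk⇔ (λ eq → sym (inverseˡ (sym eq))) inverseʳ

  no-loop : ∀ {x} i → S x → (∀ j → j ≢ i → x j ≡ 0#) → x i ≡ 0#
  no-loop {x} i x∈S vanishes-off-i with x i ≟F 0#
  ... | yes xi≡0 = xi≡0
  ... | no xi≢0  = contradiction (to (proj₂ iso K) K-circuit) not-A₃-circuit
    where
    K : Fin 3 → Bool
    K j = ⌊ j ∈? i ∷ [] ⌋

    K-true⇔ : ∀ j → (K j ≡ true) ⇔ (j ≡ i)
    K-true⇔ j = mk⇔ (λ { (here j≡i) → j≡i ; (there ()) }) here ⇔-∘ ⌊⌋-true⇔ (j ∈? _)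

    x-nonzero⇔ : ∀ j → (K j ≡ true) ⇔ (x j ≢ 0#)
    x-nonzero⇔ j = mk⇔ (λ Kj → subst (λ k → x k ≢ 0#) (sym (to (K-true⇔ j) Kj)) xi≢0)
                       (from (K-true⇔ j) ∘ nonzero-at-i)
      where
      nonzero-at-i : x j ≢ 0# → j ≡ i
      nonzero-at-i xj≢0 with j ≟F i
      ... | yes j≡i = j≡i
      ... | no j≢i  = contradiction (vanishes-off-i j j≢i) xj≢0

    K-circuit : IsCircuit F S K
    K-circuit = (x , x∈S , (i , xi≢0) , support-≐ F x x-nonzero⇔) , minimal
      where
      minimal : ∀ K′ → IsSupportOf F S K′ → K′ ⊆ K → K′ ≐ K
      minimal K′ (y , _ , (j , yj≢0) , y≐K′) K′⊆K = ⊆-antisym K′⊆K K⊆K′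
        where
        K′j : K′ j ≡ true
        K′j = trans (sym (y≐K′ j)) (from (support-true⇔ F y j) yj≢0)
        K⊆K′ : K ⊆ K′
        K⊆K′ w Kw = subst (λ w → K′ w ≡ true)
                      (trans (to (K-true⇔ j) (K′⊆K j K′j)) (sym (to (K-true⇔ w) Kw))) K′j

    not-A₃-circuit : ¬ A₃-circuit (K ∘ σ⁻¹)
    not-A₃-circuit (e , f , e≢f , K∘σ⁻¹⇔) =
      e≢f (trans (at-i e (inj₁ refl)) (sym (at-i f (inj₂ refl))))
      where
      at-i : ∀ g → g ≡ e ⊎ g ≡ f → g ≡ σ i
      at-i g = to σ⁻¹≡⇔ ∘ to (K-true⇔ (σ⁻¹ g)) ∘ from (K∘σ⁻¹⇔ g)

  pair-support : ∀ i j → i ≢ j →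
    ∃[ x ] (S x × x i ≢ 0# × x j ≢ 0# × (∀ k → k ≢ i → k ≢ j → x k ≡ 0#))
  pair-support i j i≢j = support-of (from (proj₂ iso K) A₃-pair)
    where
    K : Fin 3 → Bool
    K k = ⌊ k ∈? i ∷ j ∷ [] ⌋

    K-true⇔ : ∀ k → (K k ≡ true) ⇔ (k ≡ i ⊎ k ≡ j)
    K-true⇔ k = ∈-pair⇔ ⇔-∘ ⌊⌋-true⇔ (k ∈? _)

    A₃-pair : A₃-circuit (K ∘ σ⁻¹)
    A₃-pair = σ i , σ j , σi≢σj , λ g →
      mk⇔ (Sum.map (to σ⁻¹≡⇔) (to σ⁻¹≡⇔)) (Sum.map (from σ⁻¹≡⇔) (from σ⁻¹≡⇔))
      ⇔-∘ K-true⇔ (σ⁻¹ g)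
      where
      σi≢σj : σ i ≢ σ j
      σi≢σj σi≡σj = i≢j (trans (sym (from σ⁻¹≡⇔ refl)) (from σ⁻¹≡⇔ σi≡σj))

    support-of : IsCircuit F S K →
      ∃[ x ] (S x × x i ≢ 0# × x j ≢ 0# × (∀ k → k ≢ i → k ≢ j → x k ≡ 0#))
    support-of ((x , x∈S , _ , x≐K) , _) =
      x , x∈S , nonzero (inj₁ refl) , nonzero (inj₂ refl) , λ k k≢i k≢j →
        support-false⇒≡0 F x k (trans (x≐K k) (¬-not (λ Kk → [ k≢i , k≢j ]′ (to (K-true⇔ k) Kk))))
      where
      nonzero : ∀ {k} → k ≡ i ⊎ k ≡ j → x k ≢ 0#
      nonzero {k} k∈ = to (support-true⇔ F x k) (trans (x≐K k) (from (K-true⇔ k) k∈))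

  difference-∈ : ∀ {x y} → S x → S y → S (λ i → x i + - 1# * y i)
  difference-∈ {x} {y} x∈S y∈S = +-∈ x _ x∈S (·-∈ (- 1#) y y∈S)

  parametrisation : Parametrisation F S
  parametrisation with pair-support 0F 1F (λ ()) | pair-support 1F 2F (λ ())
  ... | u , u∈S , u₀≢0 , u₁≢0 , u-off | v , v∈S , v₁≢0 , v₂≢0 , v-off = record
    { κ = κ ; κ≢0 = κ≢0 ; point = point ; point-∈ = point-∈
    ; point₀ = point₀ ; point₁ = point₁ ; point₂ = point₂ ; middle = middle }
    where
    u₂≡0 : u 2F ≡ 0#
    u₂≡0 = u-off 2F (λ ()) (λ ())
    v₀≡0 : v 0F ≡ 0#
    v₀≡0 = v-off 0F (λ ()) (λ ())

    -- u and v are rescaled so that they agree in the middle coordinate.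
    point : Fin q → Fin q → Vector F 3
    point a b i = a * v 1F * u i + b * u 1F * v i

    κ : Fin 3 → Fin q
    κ 0F = v 1F * u 0F
    κ 1F = u 1F * v 1F
    κ 2F = u 1F * v 2F

    κ≢0 : ∀ p → κ p ≢ 0#
    κ≢0 0F = *-≢0 v₁≢0 u₀≢0
    κ≢0 1F = *-≢0 u₁≢0 v₁≢0
    κ≢0 2F = *-≢0 u₁≢0 v₂≢0

    point-∈ : ∀ a b → S (point a b)
    point-∈ a b = +-∈ _ _ (·-∈ (a * v 1F) u u∈S) (·-∈ (b * u 1F) v v∈S)

    point₀ : ∀ a b → point a b 0F ≡ a * κ 0F
    point₀ a b = begin
      a * v 1F * u 0F + b * u 1F * v 0F
        ≡⟨ cong (a * v 1F * u 0F +_) (trans (cong (b * u 1F *_) v₀≡0) (zeroʳ _)) ⟩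
      a * v 1F * u 0F + 0#
        ≡⟨ +-identityʳ _ ⟩
      a * v 1F * u 0F
        ≡⟨ *-assoc a (v 1F) (u 0F) ⟩
      a * κ 0F
        ∎

    point₁ : ∀ a b → point a b 1F ≡ (a + b) * κ 1F
    point₁ a b = begin
      a * v 1F * u 1F + b * u 1F * v 1F
        ≡⟨ cong₂ _+_ (trans (*-assoc a (v 1F) (u 1F)) (cong (a *_) (*-comm (v 1F) (u 1F))))
                     (*-assoc b (u 1F) (v 1F)) ⟩
      a * κ 1F + b * κ 1F
        ≡⟨ sym (distribʳ (κ 1F) a b) ⟩
      (a + b) * κ 1F
        ∎

    point₂ : ∀ a b → point a b 2F ≡ b * κ 2F
    point₂ a b = begin
      a * v 1F * u 2F + b * u 1F * v 2F
        ≡⟨ cong (_+ b * u 1F * v 2F) (trans (cong (a * v 1F *_) u₂≡0) (zeroʳ _)) ⟩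
      0# + b * u 1F * v 2F
        ≡⟨ +-identityˡ _ ⟩
      b * u 1F * v 2F
        ≡⟨ *-assoc b (u 1F) (v 2F) ⟩
      b * κ 2F
        ∎

    middle : ∀ {x} a b → S x → x 0F ≡ a * κ 0F → x 2F ≡ b * κ 2F → x 1F ≡ (a + b) * κ 1F
    middle {x} a b x∈S x₀ x₂ = trans (to (x-y≡0⇔x≡y _ _) (x-point≡0 1F)) (point₁ a b)
      where
      x-point≡0 : ∀ i → x i + - 1# * point a b i ≡ 0#
      x-point≡0 0F = from (x-y≡0⇔x≡y _ _) (trans x₀ (sym (point₀ a b)))
      x-point≡0 2F = from (x-y≡0⇔x≡y _ _) (trans x₂ (sym (point₂ a b)))
      x-point≡0 1F = no-loop 1F (difference-∈ x∈S (point-∈ a b)) λ where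
        0F _ → x-point≡0 0F
        1F 1≢1 → contradiction refl 1≢1
        2F _ → x-point≡0 2F

-- The scalars e, f, g

record CycleScalars {q : ℕ} (F : FieldOn q) : Set where
  open FieldProperties F
  field
    e f g : Fin q
    e≢0 : e ≢ 0#
    f≢0 : f ≢ 0#
    g∉  : g ∉ 0# ∷ e ∷ f ∷ e + f ∷ []

  middleRow : List (Fin q)
  middleRow = g ∷ e ∷ f ∷ e + f ∷ []

  -- The pairs (a, b) ∈ {0, e, g} × {0, f, g} whose sum must avoid middleRow: all but the
  -- five (0, f), (e, f), (e, 0), (g, 0), (0, g) giving the edges of the pentagon.
  field
    0+0∉middleRow : 0# + 0# ∉ middleRow
    e+g∉middleRow : e + g ∉ middleRow
    g+f∉middleRow : g + f ∉ middleRow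
    g+g∉middleRow : g + g ∉ middleRow

module _ {q : ℕ} (F : FieldOn q) where
  open FieldProperties F

  cycleScalars-char≢2 : (2≢0 : 1# + 1# ≢ 0#) →
    ∃ (_∉ 0# ∷ 1# ∷ 1# + 1# ∷ proj₁ (inverse _ 2≢0) ∷ []) → CycleScalars F
  cycleScalars-char≢2 2≢0 (g , g∉) = record
    { e = 1# ; f = 1# ; g = g ; e≢0 = 1≢0 ; f≢0 = 1≢0
    ; g∉ = All¬⇒¬Any (g≢0 ∷ g≢1 ∷ g≢1 ∷ g∉ ∘ there ∘ there ∘ here ∷ [])
    ; 0+0∉middleRow = subst (_∉ g ∷ 1# ∷ 1# ∷ 1# + 1# ∷ []) (sym (+-identityʳ 0#))
        (All¬⇒¬Any (g≢0 ∘ sym ∷ 0≢1 ∷ 0≢1 ∷ 2≢0 ∘ sym ∷ []))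
    ; e+g∉middleRow = All¬⇒¬Any
        (1≢0 ∘ +-identityˡ-unique 1# g ∷ g≢0 ∘ +-identityʳ-unique 1# g ∷
         g≢0 ∘ +-identityʳ-unique 1# g ∷ g≢1 ∘ +-cancelˡ 1# g 1# ∷ [])
    ; g+f∉middleRow = All¬⇒¬Any
        (1≢0 ∘ +-identityʳ-unique g 1# ∷ g≢0 ∘ +-identityˡ-unique g 1# ∷
         g≢0 ∘ +-identityˡ-unique g 1# ∷ g≢1 ∘ +-cancelʳ 1# g 1# ∷ [])
    ; g+g∉middleRow = All¬⇒¬Any
        (g≢0 ∘ +-identityʳ-unique g g ∷ g≢½ ∘ halve ∷ g≢½ ∘ halve ∷ g≢1 ∘ double-injective ∷ [])
    }
    where
    ½ : Fin q
    ½ = proj₁ (inverse _ 2≢0)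

    g≢0 : g ≢ 0#
    g≢0 = g∉ ∘ here
    g≢1 : g ≢ 1#
    g≢1 = g∉ ∘ there ∘ here
    g≢½ : g ≢ ½
    g≢½ = g∉ ∘ there ∘ there ∘ there ∘ here

    double-injective : ∀ {x y} → x + x ≡ y + y → x ≡ y
    double-injective {x} {y} eq =
      *-cancelʳ-≢0 2≢0 x y (trans (sym (x+x≡x*2 x)) (trans eq (x+x≡x*2 y)))

    halve : g + g ≡ 1# → g ≡ ½
    halve g+g≡1 = double-injective
      (trans g+g≡1 (sym (trans (x+x≡x*2 ½) (trans (*-comm ½ _) (proj₂ (inverse _ 2≢0))))))

  cycleScalars-char2 : 1# + 1# ≡ 0# → (f-fresh : ∃ (_∉ 0# ∷ 1# ∷ [])) →
    ∃ (_∉ 0# ∷ 1# ∷ proj₁ f-fresh ∷ 1# + proj₁ f-fresh ∷ []) → CycleScalars F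
  cycleScalars-char2 2≡0 (f , f∉) (g , g∉) = record
    { e = 1# ; f = f ; g = g ; e≢0 = 1≢0 ; f≢0 = f≢0 ; g∉ = g∉
    ; 0+0∉middleRow = subst (_∉ middleRow) (sym (+-identityʳ 0#)) 0∉middleRow
    ; e+g∉middleRow = All¬⇒¬Any
        (1≢0 ∘ +-identityˡ-unique 1# g ∷ g≢0 ∘ +-identityʳ-unique 1# g ∷ g≢1+f ∘ move ∷
         g≢f ∘ +-cancelˡ 1# g f ∷ [])
    ; g+f∉middleRow = All¬⇒¬Any
        (f≢0 ∘ +-identityʳ-unique g f ∷ g≢1+f ∘ moveˡ ∷ g≢0 ∘ +-identityˡ-unique g f ∷
         g≢1 ∘ +-cancelʳ f g 1# ∷ [])
    ; g+g∉middleRow = subst (_∉ middleRow) (sym (x+x≡0 g)) 0∉middleRow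
    }
    where
    middleRow : List (Fin q)
    middleRow = g ∷ 1# ∷ f ∷ 1# + f ∷ []

    f≢0 : f ≢ 0#
    f≢0 = f∉ ∘ here
    g≢0 : g ≢ 0#
    g≢0 = g∉ ∘ here
    g≢1 : g ≢ 1#
    g≢1 = g∉ ∘ there ∘ here
    g≢f : g ≢ f
    g≢f = g∉ ∘ there ∘ there ∘ here
    g≢1+f : g ≢ 1# + f
    g≢1+f = g∉ ∘ there ∘ there ∘ there ∘ here

    x+x≡0 : ∀ x → x + x ≡ 0#
    x+x≡0 x = trans (x+x≡x*2 x) (trans (cong (x *_) 2≡0) (zeroʳ x))

    move : ∀ {a b c} → a + b ≡ c → b ≡ a + c
    move {a} {b} {c} a+b≡c = +-cancelˡ a b (a + c) (begin
      a + b        ≡⟨ a+b≡c ⟩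
      c            ≡⟨ sym (+-identityˡ c) ⟩
      0# + c       ≡⟨ cong (_+ c) (sym (x+x≡0 a)) ⟩
      a + a + c    ≡⟨ +-assoc a a c ⟩
      a + (a + c)  ∎)
      where open ≡-Reasoning

    moveˡ : ∀ {a b c} → a + b ≡ c → a ≡ c + b
    moveˡ {a} {b} {c} a+b≡c = trans (move (trans (+-comm b a) a+b≡c)) (+-comm b c)

    1+f≢0 : 1# + f ≢ 0#
    1+f≢0 1+f≡0 = f∉ (there (here (trans (move 1+f≡0) (+-identityʳ 1#))))

    0∉middleRow : 0# ∉ middleRow
    0∉middleRow = All¬⇒¬Any (g≢0 ∘ sym ∷ 0≢1 ∷ f≢0 ∘ sym ∷ 1+f≢0 ∘ sym ∷ [])

  cycleScalars : 4 < q → CycleScalars F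
  cycleScalars 4<q with 1# + 1# ≟F 0#
  ... | no 2≢0  = cycleScalars-char≢2 2≢0 (∃-∉ _ 4<q)
  ... | yes 2≡0 = cycleScalars-char2 2≡0 f-fresh (∃-∉ _ 4<q)
    where
    f-fresh : ∃ (_∉ 0# ∷ 1# ∷ [])
    f-fresh = ∃-∉ (0# ∷ 1# ∷ []) (<-trans (s≤s (s≤s (s≤s z≤n))) 4<q)

-- The C₅² minor

module CycleMinor {q : ℕ} (F : FieldOn q) {S : Vector F 3 → Set}
                  (P : Parametrisation F S) (C : CycleScalars F) where
  open FieldProperties F
  open Parametrisation P
  open CycleScalars C
  open Mult F {3}
  open DecMembership (_≟F_ {q}) using (_∈?_)

  Row : Set
  Row = Fin 3 → List (Fin q)

  -- Rows of scalars t, standing for the values t κ_p in the copy V_p.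
  survivorRow contractedRow keptRow : Row
  survivorRow 0F = 0# ∷ e ∷ []
  survivorRow 1F = g ∷ []
  survivorRow 2F = 0# ∷ f ∷ []
  contractedRow 0F = g ∷ []
  contractedRow 1F = e ∷ f ∷ e + f ∷ []
  contractedRow 2F = g ∷ []
  keptRow p = survivorRow p ++ contractedRow p

  _∈ʳ_ : Ground F 3 → Row → Set
  (p , c) ∈ʳ r = ∃[ t ] (t ∈ r p × c ≡ coord p t)

  rowSet : Row → Ground F 3 → Bool
  rowSet r (p , c) = ⌊ c ∈? map (coord p) (r p) ⌋

  rowSet-true⇔ : ∀ r v → (rowSet r v ≡ true) ⇔ (v ∈ʳ r)
  rowSet-true⇔ r (p , c) =
    mk⇔ (∈-map⁻ (coord p)) (λ { (t , t∈ , refl) → ∈-map⁺ (coord p) t∈ })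
    ⇔-∘ ⌊⌋-true⇔ (c ∈? _)

  rowSet-false : ∀ r v → ¬ v ∈ʳ r → rowSet r v ≡ false
  rowSet-false r v v∉r = ¬-not (v∉r ∘ to (rowSet-true⇔ r v))

  contracted deleted : Ground F 3 → Bool
  contracted = rowSet contractedRow
  deleted v = not (rowSet keptRow v)

  deleted-false⇔ : ∀ v → (deleted v ≡ false) ⇔ (v ∈ʳ keptRow)
  deleted-false⇔ v = rowSet-true⇔ keptRow v ⇔-∘ mk⇔ (not-injective {y = true}) (cong not)

  survivor⇒kept : ∀ {v} → v ∈ʳ survivorRow → v ∈ʳ keptRow
  survivor⇒kept (t , t∈ , c≡) = t , ∈-++⁺ˡ t∈ , c≡

  contracted⇒kept : ∀ {v} → v ∈ʳ contractedRow → v ∈ʳ keptRow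
  contracted⇒kept {p , _} (t , t∈ , c≡) = t , ∈-++⁺ʳ (survivorRow p) t∈ , c≡

  kept⇒survivor⊎contracted : ∀ {v} → v ∈ʳ keptRow → v ∈ʳ survivorRow ⊎ v ∈ʳ contractedRow
  kept⇒survivor⊎contracted {p , _} (t , t∈ , c≡) =
    Sum.map (λ t∈ → t , t∈ , c≡) (λ t∈ → t , t∈ , c≡) (∈-++⁻ (survivorRow p) t∈)

  coord-injective : ∀ p {s t} → coord p s ≡ coord p t → s ≡ t
  coord-injective p = *-cancelʳ-≢0 (κ≢0 p) _ _

  survivor≢contracted : ∀ p {s t} → s ∈ survivorRow p → t ∈ contractedRow p → s ≢ t
  survivor≢contracted 0F (here refl)        (here refl) 0≡g = g∉ (here (sym 0≡g))
  survivor≢contracted 0F (there (here refl)) (here refl) e≡g = g∉ (there (here (sym e≡g)))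
  survivor≢contracted 1F (here refl) (here refl)                 g≡e   = g∉ (there (here g≡e))
  survivor≢contracted 1F (here refl) (there (here refl))         g≡f   = g∉ (there (there (here g≡f)))
  survivor≢contracted 1F (here refl) (there (there (here refl))) g≡e+f = g∉ (there (there (there (here g≡e+f))))
  survivor≢contracted 2F (here refl)        (here refl) 0≡g = g∉ (here (sym 0≡g))
  survivor≢contracted 2F (there (here refl)) (here refl) f≡g = g∉ (there (there (here (sym f≡g))))

  survivor-not-contracted : ∀ {v} → v ∈ʳ survivorRow → ¬ v ∈ʳ contractedRow
  survivor-not-contracted {p , _} (s , s∈ , refl) (t , t∈ , c≡) =
    survivor≢contracted p s∈ t∈ (coord-injective p c≡)

  ground⇔survivor : ∀ v → InMinorGround deleted contracted v ⇔ v ∈ʳ survivorRow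
  ground⇔survivor v = mk⇔ ground⇒survivor survivor⇒ground
    where
    ground⇒survivor : InMinorGround deleted contracted v → v ∈ʳ survivorRow
    ground⇒survivor (not-deleted , not-contracted)
      with kept⇒survivor⊎contracted (to (deleted-false⇔ v) not-deleted)
    ... | inj₁ v∈R = v∈R
    ... | inj₂ v∈J = contradiction (trans (sym not-contracted) (from (rowSet-true⇔ contractedRow v) v∈J)) λ ()

    survivor⇒ground : v ∈ʳ survivorRow → InMinorGround deleted contracted v
    survivor⇒ground v∈R = from (deleted-false⇔ v) (survivor⇒kept v∈R)
                        , rowSet-false contractedRow v (survivor-not-contracted v∈R)

  φ : Fin 5 → Ground F 3
  φ 0F = 0F , coord 0F 0#
  φ 1F = 2F , coord 2F f
  φ 2F = 0F , coord 0F e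
  φ 3F = 2F , coord 2F 0#
  φ 4F = 1F , coord 1F g

  φ-survivor : ∀ i → φ i ∈ʳ survivorRow
  φ-survivor 0F = 0# , here refl , refl
  φ-survivor 1F = f , there (here refl) , refl
  φ-survivor 2F = e , there (here refl) , refl
  φ-survivor 3F = 0# , here refl , refl
  φ-survivor 4F = g , here refl , refl

  survivor-onto : ∀ {v} → v ∈ʳ survivorRow → ∃[ i ] (φ i ≡ v)
  survivor-onto {0F , _} (_ , here refl , refl)         = 0F , refl
  survivor-onto {0F , _} (_ , there (here refl) , refl) = 2F , refl
  survivor-onto {1F , _} (_ , here refl , refl)         = 4F , refl
  survivor-onto {2F , _} (_ , here refl , refl)         = 3F , refl
  survivor-onto {2F , _} (_ , there (here refl) , refl) = 1F , refl

  φ⁻¹ : Ground F 3 → Fin 5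
  φ⁻¹ (0F , c) = if ⌊ c ≟F coord 0F 0# ⌋ then 0F else 2F
  φ⁻¹ (1F , _) = 4F
  φ⁻¹ (2F , c) = if ⌊ c ≟F coord 2F f ⌋ then 1F else 3F

  φ⁻¹∘φ : ∀ i → φ⁻¹ (φ i) ≡ i
  φ⁻¹∘φ 0F rewrite from (⌊⌋-true⇔ (coord 0F 0# ≟F coord 0F 0#)) refl = refl
  φ⁻¹∘φ 1F rewrite from (⌊⌋-true⇔ (coord 2F f ≟F coord 2F f)) refl = refl
  φ⁻¹∘φ 2F rewrite ⌊⌋-false (coord 0F e ≟F coord 0F 0#) (e≢0 ∘ coord-injective 0F) = refl
  φ⁻¹∘φ 3F rewrite ⌊⌋-false (coord 2F 0# ≟F coord 2F f) (f≢0 ∘ sym ∘ coord-injective 2F) = refl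
  φ⁻¹∘φ 4F = refl

  φ-injective : Injective _≡_ _≡_ φ
  φ-injective {i} {j} φi≡φj = trans (sym (φ⁻¹∘φ i)) (trans (cong φ⁻¹ φi≡φj) (φ⁻¹∘φ j))

  φ-ground : ∀ i → InMinorGround deleted contracted (φ i)
  φ-ground i = from (ground⇔survivor (φ i)) (φ-survivor i)

  ground-onto : ∀ v → InMinorGround deleted contracted v → ∃[ i ] (φ i ≡ v)
  ground-onto v = survivor-onto ∘ to (ground⇔survivor v)

  open Pentagon (≡-dec _≟F_ _≟F_) (InMinorGround deleted contracted) φ φ-injective φ-ground ground-onto

  Passes : Vector F 3 → Fin 5 → Set
  Passes x k = x ∋ φ k × x ∋ φ (next5 k)

  edge-on : ∀ {x k} → Passes x k → ∀ v → edge k v ≡ true → x ∋ v × contracted v ≡ false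
  edge-on {k = k} (x∋φk , x∋φk′) v Ekv with to (edge-true⇔ k v) Ekv
  ... | inj₁ refl = x∋φk , proj₂ (φ-ground k)
  ... | inj₂ refl = x∋φk′ , proj₂ (φ-ground (next5 k))

  passes-some-edge : ∀ {x} → S x → (∀ p → deleted (p , x p) ≡ false) → ∃[ k ] (Passes x k)
  passes-some-edge {x} x∈S kept
    with to (deleted-false⇔ _) (kept 0F) | to (deleted-false⇔ _) (kept 2F) | to (deleted-false⇔ _) (kept 1F)
  ... | a , a∈ , x₀ | b , b∈ , x₂ | m , m∈ , x₁ = by-cases a∈ b∈ a+b∈ x₀ x₂ x₁′
    where
    x₁′ : x 1F ≡ coord 1F (a + b)
    x₁′ = middle a b x∈S x₀ x₂
    a+b∈ : a + b ∈ middleRow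
    a+b∈ = subst (_∈ middleRow) (coord-injective 1F (trans (sym x₁) x₁′)) m∈

    by-cases : ∀ {a b} → a ∈ keptRow 0F → b ∈ keptRow 2F → a + b ∈ middleRow →
               x 0F ≡ coord 0F a → x 2F ≡ coord 2F b → x 1F ≡ coord 1F (a + b) → ∃[ k ] (Passes x k)
    by-cases (here refl) (here refl) 0+0∈ _ _ _ = contradiction 0+0∈ 0+0∉middleRow
    by-cases (here refl) (there (here refl)) _ x₀ x₂ _ = 0F , x₀ , x₂
    by-cases (here refl) (there (there (here refl))) _ x₀ _ x₁ =
      4F , trans x₁ (cong (coord 1F) (+-identityˡ g)) , x₀
    by-cases (there (here refl)) (here refl) _ x₀ x₂ _ = 2F , x₀ , x₂
    by-cases (there (here refl)) (there (here refl)) _ x₀ x₂ _ = 1F , x₂ , x₀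
    by-cases (there (here refl)) (there (there (here refl))) e+g∈ _ _ _ = contradiction e+g∈ e+g∉middleRow
    by-cases (there (there (here refl))) (here refl) _ _ x₂ x₁ =
      3F , x₂ , trans x₁ (cong (coord 1F) (+-identityʳ g))
    by-cases (there (there (here refl))) (there (here refl)) g+f∈ _ _ _ = contradiction g+f∈ g+f∉middleRow
    by-cases (there (there (here refl))) (there (there (here refl))) g+g∈ _ _ _ =
      contradiction g+g∈ g+g∉middleRow

  Covers : Vector F 3 → Fin 5 → Set
  Covers x k = ∀ p → p ≡ proj₁ (φ k) ⊎ p ≡ proj₁ (φ (next5 k)) ⊎ (p , x p) ∈ʳ contractedRow

  realise : ∀ k → ∃[ x ] (S x × Passes x k × Covers x k)
  realise 0F = point 0# f , point-∈ 0# f , (point₀ 0# f , point₂ 0# f) , λ where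
    0F → inj₁ refl
    1F → inj₂ (inj₂ (f , there (here refl) , trans (point₁ 0# f) (cong (coord 1F) (+-identityˡ f))))
    2F → inj₂ (inj₁ refl)
  realise 1F = point e f , point-∈ e f , (point₂ e f , point₀ e f) , λ where
    0F → inj₂ (inj₁ refl)
    1F → inj₂ (inj₂ (e + f , there (there (here refl)) , point₁ e f))
    2F → inj₁ refl
  realise 2F = point e 0# , point-∈ e 0# , (point₀ e 0# , point₂ e 0#) , λ where
    0F → inj₁ refl
    1F → inj₂ (inj₂ (e , here refl , trans (point₁ e 0#) (cong (coord 1F) (+-identityʳ e))))
    2F → inj₂ (inj₁ refl)
  realise 3F = point g 0# , point-∈ g 0#
             , (point₂ g 0# , trans (point₁ g 0#) (cong (coord 1F) (+-identityʳ g))) , λ where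
    0F → inj₂ (inj₂ (g , here refl , point₀ g 0#))
    1F → inj₂ (inj₁ refl)
    2F → inj₁ refl
  realise 4F = point 0# g , point-∈ 0# g
             , (trans (point₁ 0# g) (cong (coord 1F) (+-identityˡ g)) , point₀ 0# g) , λ where
    0F → inj₂ (inj₁ refl)
    1F → inj₁ refl
    2F → inj₂ (inj₂ (g , here refl , point₂ 0# g))

  position : ∀ {x k} → Passes x k → Covers x k →
             ∀ p → (p , x p) ≡ φ k ⊎ (p , x p) ≡ φ (next5 k) ⊎ (p , x p) ∈ʳ contractedRow
  position {x} {k} (x∋φk , x∋φk′) covers p with covers p
  ... | inj₁ refl        = inj₁ (∋⇒graph {x} {φ k} x∋φk)
  ... | inj₂ (inj₁ refl) = inj₂ (inj₁ (∋⇒graph {x} {φ (next5 k)} x∋φk′))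
  ... | inj₂ (inj₂ x∈J)  = inj₂ (inj₂ x∈J)

  edge-candidate : ∀ k → minorCandidate (mult F S) deleted contracted (edge k)
  edge-candidate k with realise k
  ... | x , x∈S , passes , covers =
    from (mult-candidate⇔ (edge k))
      (x , x∈S , kept , λ v → sym (memberOf-∸-≐ x (edge k) contracted (edge-on passes) cover v))
    where
    kept : ∀ p → deleted (p , x p) ≡ false
    kept p with position {x} {k} passes covers p
    ... | inj₁ eq        = subst (λ w → deleted w ≡ false) (sym eq) (proj₁ (φ-ground k))
    ... | inj₂ (inj₁ eq) = subst (λ w → deleted w ≡ false) (sym eq) (proj₁ (φ-ground (next5 k)))
    ... | inj₂ (inj₂ x∈J) = from (deleted-false⇔ _) (contracted⇒kept x∈J)

    cover : ∀ p → edge k (p , x p) ≡ true ⊎ contracted (p , x p) ≡ true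
    cover p with position {x} {k} passes covers p
    ... | inj₁ eq         = inj₁ (from (edge-true⇔ k _) (inj₁ eq))
    ... | inj₂ (inj₁ eq)  = inj₁ (from (edge-true⇔ k _) (inj₂ eq))
    ... | inj₂ (inj₂ x∈J) = inj₂ (from (rowSet-true⇔ contractedRow _) x∈J)

  candidate-⊇-edge : ∀ D → minorCandidate (mult F S) deleted contracted D → ∃[ k ] (edge k ⊆ D)
  candidate-⊇-edge D candidate with to (mult-candidate⇔ D) candidate
  ... | x , x∈S , kept , D≐ with passes-some-edge x∈S kept
  ...   | k , passes = k , λ v Ekv → trans (D≐ v) (⊆-memberOf-∸ x (edge k) contracted (edge-on passes) v Ekv)

  deleted-disjoint-contracted : Disjoint deleted contracted
  deleted-disjoint-contracted v deleted-v = rowSet-false contractedRow v λ v∈J →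
    contradiction (trans (sym deleted-v) (from (deleted-false⇔ v) (contracted⇒kept v∈J))) λ ()

  hasC₅²Minor : HasC₅²Minor (mult F S)
  hasC₅²Minor = deleted , contracted , deleted-disjoint-contracted
              , φ , φ-injective , φ-ground , ground-onto
              , λ D → ≐edge⇔C₅² D ⇔-∘ minor⇔≐ edge edge-candidate candidate-⊇-edge edge-antichain D

lemma8p1 : (q : ℕ) → IsPowerOf2 q → 4 < q → (F : FieldOn q) →
           (S : (Fin 3 → Fin q) → Set) → IsSubspace F S →
           MatroidIsoA₃ F S → HasC₅²Minor (mult F S)
lemma8p1 q _ 4<q F S S-subspace iso =
  CycleMinor.hasC₅²Minor F (SubspaceOfA₃.parametrisation F S-subspace iso) (cycleScalars F 4<q)
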